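{- Let $q\ge2$ be a prime power and let $n,k,t,s$ be positive integers with $k\ge t+2$ and $n\ge 3k+3t+1+\log_q(13s)$. Let $$g_1(n,k,t,s)=\left({n-t\brack k-t}-q^{(k-t)(k+1-t)}{n-k-1\brack k-t}+s\right)\left({n-t\brack k-t}+\min\{s,q^{k-t+1}{t\brack 1}\}\right).$$ Then (i) $g_1(n,k,t,s)>\frac{25}{26}{k-t+1\brack 1}{n-t-1\brack k-t-1}{n-t\brack k-t}$; and (ii) $g_1(n,k,t,s)>\left({k-t+1\brack 1}{n-t-1\brack k-t-1}+s\right)^2$.
   Context: Gaussian binomial: ${a\brack b}=\prod_{0\le i<b}\frac{q^{a-i}-1}{q^{b-i}-1}$ for positive integers $a,b$, ${a\brack 0}=1$, ${a\brack b}=0$ for $b<0$. -}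

module Defs where

open import Data.Nat as N using (ℕ; zero; suc; _∸_; _^_)
open import Data.Integer using (+_)
open import Data.Rational using (ℚ; _/_; _*_; _+_; _-_; _⊓_; 0ℚ; 1ℚ)
open import Data.List using (map; foldr; upTo)

-- a / d in ℚ, with the (never used for q ≥ 2) convention x/0 = 0
frac : ℕ → ℕ → ℚ
frac a zero    = 0ℚ
frac a (suc d) = (+ a) / suc d

gauss : ℕ → ℕ → ℕ → ℚ
gauss q a b = foldr _*_ 1ℚ (map (λ i → frac (q ^ (a ∸ i) ∸ 1) (q ^ (b ∸ i) ∸ 1)) (upTo b))

ι : ℕ → ℚ
ι m = (+ m) / 1

open import Data.Nat.Primality using (Prime)
open import Data.Product using (Σ; _×_)
open import Relation.Binary.PropositionalEquality using (_≡_)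

IsPrimePower : ℕ → Set
IsPrimePower q = Σ ℕ λ p → Σ ℕ λ m → Prime p × (1 N.≤ m) × (q ≡ p ^ m)

g₁ : ℕ → ℕ → ℕ → ℕ → ℕ → ℚ
g₁ q n k t s =
  (gauss q (n ∸ t) (k ∸ t) - ι (q ^ ((k ∸ t) N.* (k N.+ 1 ∸ t))) * gauss q (n ∸ k ∸ 1) (k ∸ t) + ι s)
  * (gauss q (n ∸ t) (k ∸ t) + (ι s ⊓ (ι (q ^ (k ∸ t N.+ 1)) * gauss q t 1)))

{-# OPTIONS --safe #-}
module Submission where

-- With a = k − t, M = n − k − 1 and m = n − t, the first factor of g₁ is G − H + s, where
-- G = [m, a] and H = q^(a(a+1)) [M, a]. Comparing the two products factor by factor gives
-- H = G ∏_{i<a} (1 − r_i) with r_i = (q^(a+1) − 1)/(q^(m−i) − 1); as n is large, every r_i is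
-- at most 1/(26a), so by Bonferroni G − H ≥ (Σr − (Σr)²) G ≥ (25/26) (Σr) G. Bounding r_i below
-- by q^i (q^(a+1) − 1)/(q^m − 1) and summing the geometric series gives (Σr) G ≥ B, where
-- B = [a+1, 1][m−1, a−1]; hence G − H ≥ (25/26) B. The hypothesis on s yields 2(B + s) ≤ G, and
-- both bounds are then elementary inequalities between B, G, G − H and s.

open import Data.List using (foldr; applyUpTo)
import Data.List.Properties as List
open import Data.Nat as ℕ using (ℕ; zero; suc; s≤s; z≤n)
import Data.Nat.Properties as ℕP
open import Data.Nat.ListAction using (sum)
import Data.Nat.Tactic.RingSolver as ℕSolver
open import Function using (_∘_)
open import Relation.Binary.PropositionalEquality

open import Defs

sum-applyUpTo-* : ∀ c f n → sum (applyUpTo (λ i → c ℕ.* f i) n) ≡ c ℕ.* sum (applyUpTo f n)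
sum-applyUpTo-* c f zero    = sym (ℕP.*-zeroʳ c)
sum-applyUpTo-* c f (suc n) = trans (cong (c ℕ.* f 0 ℕ.+_) (sum-applyUpTo-* c (f ∘ suc) n)) (sym (ℕP.*-distribˡ-+ c (f 0) _))

module Powers (p : ℕ) where
  open import Data.Nat using (_+_; _*_; _∸_; _^_; _≤_; _<_)

  q : ℕ
  q = 2 + p

  2≤q : 2 ≤ q
  2≤q = s≤s (s≤s z≤n)

  1≤q^ : ∀ j → 1 ≤ q ^ j
  1≤q^ = ℕP.m^n>0 q

  0<q^-1 : ∀ j → 1 ≤ j → 0 < q ^ j ∸ 1
  0<q^-1 j 1≤j = ℕP.m<n⇒0<n∸m (ℕP.^-monoʳ-< q 2≤q 1≤j)

  q^-1-mono : ∀ {j j′} → j ≤ j′ → q ^ j ∸ 1 ≤ q ^ j′ ∸ 1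
  q^-1-mono j≤j′ = ℕP.∸-monoˡ-≤ 1 (ℕP.^-monoʳ-≤ q j≤j′)

  n<q^n : ∀ n → n < q ^ n
  n<q^n zero    = ℕ.z<s
  n<q^n (suc n) = ℕP.+-mono-≤ (1≤q^ n) (ℕP.≤-trans (n<q^n n) (ℕP.m≤n*m (q ^ n) (suc p)))

  q^*[q^-1] : ∀ i j → q ^ i * (q ^ j ∸ 1) ≡ (q ^ (i + j) ∸ 1) ∸ (q ^ i ∸ 1)
  q^*[q^-1] i j = begin
    q ^ i * (q ^ j ∸ 1)                   ≡⟨ ℕP.*-distribˡ-∸ (q ^ i) (q ^ j) 1 ⟩
    q ^ i * q ^ j ∸ q ^ i * 1             ≡⟨ cong₂ _∸_ (sym (ℕP.^-distribˡ-+-* q i j)) (ℕP.*-identityʳ (q ^ i)) ⟩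
    q ^ (i + j) ∸ q ^ i                   ≡⟨ cong (q ^ (i + j) ∸_) (ℕP.m+[n∸m]≡n (1≤q^ i)) ⟨
    q ^ (i + j) ∸ (1 + (q ^ i ∸ 1))       ≡⟨ ℕP.∸-+-assoc (q ^ (i + j)) 1 (q ^ i ∸ 1) ⟨
    (q ^ (i + j) ∸ 1) ∸ (q ^ i ∸ 1)       ∎
    where open ≡-Reasoning

  q^*[q^-1]≤ : ∀ i j → q ^ i * (q ^ j ∸ 1) ≤ q ^ (i + j) ∸ 1
  q^*[q^-1]≤ i j = ℕP.≤-trans (ℕP.≤-reflexive (q^*[q^-1] i j)) (ℕP.m∸n≤m (q ^ (i + j) ∸ 1) (q ^ i ∸ 1))

  geometric-sum : ∀ n → sum (applyUpTo (q ^_) n) * (q ^ 1 ∸ 1) ≡ q ^ n ∸ 1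
  geometric-sum n = begin
    sum (applyUpTo (q ^_) n) * (q ^ 1 ∸ 1)   ≡⟨ cong (λ c → sum (applyUpTo (q ^_) n) * (c ∸ 1)) (ℕP.*-identityʳ q) ⟩
    sum (applyUpTo (q ^_) n) * suc p         ≡⟨ ℕP.m+n∸n≡m _ 1 ⟨
    sum (applyUpTo (q ^_) n) * suc p + 1 ∸ 1 ≡⟨ cong (_∸ 1) (telescope n) ⟩
    q ^ n ∸ 1                                ∎
    where
    open ≡-Reasoning
    telescope : ∀ n → sum (applyUpTo (q ^_) n) * suc p + 1 ≡ q ^ n
    telescope zero    = refl
    telescope (suc n) = begin
      (1 + sum (applyUpTo (λ i → q * q ^ i) n)) * suc p + 1 ≡⟨ cong (λ z → (1 + z) * suc p + 1) (sum-applyUpTo-* q (q ^_) n) ⟩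
      (1 + q * S) * suc p + 1                             ≡⟨ regroup p S ⟩
      q * (S * suc p + 1)                                 ≡⟨ cong (q *_) (telescope n) ⟩
      q * q ^ n                                           ∎
      where
      S : ℕ
      S = sum (applyUpTo (q ^_) n)
      regroup : ∀ p S → (1 + (2 + p) * S) * suc p + 1 ≡ (2 + p) * (S * suc p + 1)
      regroup = ℕSolver.solve-∀

  x+x+y+y≤q²*z : ∀ {x y z} → x ≤ z → y ≤ z → x + x + y + y ≤ q ^ 2 * z
  x+x+y+y≤q²*z {x} {y} {z} x≤z y≤z = begin
    x + x + y + y  ≤⟨ ℕP.+-mono-≤ (ℕP.+-mono-≤ (ℕP.+-mono-≤ x≤z x≤z) y≤z) y≤z ⟩
    z + z + z + z  ≡⟨ four-times z ⟩
    4 * z          ≤⟨ ℕP.*-monoˡ-≤ z (ℕP.^-monoˡ-≤ 2 2≤q) ⟩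
    q ^ 2 * z      ∎
    where
    open ℕP.≤-Reasoning
    four-times : ∀ z → z + z + z + z ≡ 4 * z
    four-times = ℕSolver.solve-∀

  [q^[a+1]-1]*26a≤q^j-1 : ∀ a {j} → 2 * a + 6 ≤ j → (q ^ (a + 1) ∸ 1) * (26 * a) ≤ q ^ j ∸ 1
  [q^[a+1]-1]*26a≤q^j-1 a {j} 2a+6≤j = begin
    (q ^ (a + 1) ∸ 1) * (26 * a)        ≤⟨ ℕP.*-mono-≤ (ℕP.m∸n≤m (q ^ (a + 1)) 1) (ℕP.*-mono-≤ 26≤q^5 a≤q^a-1) ⟩
    q ^ (a + 1) * (q ^ 5 * (q ^ a ∸ 1)) ≤⟨ ℕP.*-monoʳ-≤ (q ^ (a + 1)) (q^*[q^-1]≤ 5 a) ⟩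
    q ^ (a + 1) * (q ^ (5 + a) ∸ 1)     ≤⟨ q^*[q^-1]≤ (a + 1) (5 + a) ⟩
    q ^ (a + 1 + (5 + a)) ∸ 1           ≤⟨ q^-1-mono (ℕP.≤-trans (ℕP.≤-reflexive (exponent a)) 2a+6≤j) ⟩
    q ^ j ∸ 1                           ∎
    where
    open ℕP.≤-Reasoning
    26≤q^5 : 26 ≤ q ^ 5
    26≤q^5 = ℕP.≤-trans (ℕP.m≤m+n 26 6) (ℕP.^-monoˡ-≤ 5 2≤q)
    a≤q^a-1 : a ≤ q ^ a ∸ 1
    a≤q^a-1 = ℕP.∸-monoˡ-≤ 1 (n<q^n a)
    exponent : ∀ a → a + 1 + (5 + a) ≡ 2 * a + 6
    exponent = ℕSolver.solve-∀

module Reindexing {n k t : ℕ} (1≤t : 1 ℕ.≤ t) (t+2≤k : t ℕ.+ 2 ℕ.≤ k) (k-bound : 3 ℕ.* k ℕ.+ 3 ℕ.* t ℕ.+ 1 ℕ.≤ n) where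
  open import Data.Nat using (_+_; _*_; _∸_; _≤_)
  open ≡-Reasoning

  a′ A M e : ℕ
  a′ = k ∸ t ∸ 1
  A = suc a′
  M = n ∸ k ∸ 1
  e = n ∸ (3 * k + 3 * t + 1)

  k∸t≡A : k ∸ t ≡ A
  k∸t≡A = sym (ℕP.m+[n∸m]≡n (ℕP.≤-trans (s≤s z≤n)
    (ℕP.m+n≤o⇒m≤o∸n 2 (ℕP.≤-trans (ℕP.≤-reflexive (ℕP.+-comm 2 t)) t+2≤k))))

  k≡t+A : k ≡ t + A
  k≡t+A = trans (sym (ℕP.m+[n∸m]≡n (ℕP.m+n≤o⇒m≤o t t+2≤k))) (cong (t +_) k∸t≡A)

  n≡ : n ≡ 3 * (t + A) + 3 * t + 1 + e
  n≡ = trans (sym (ℕP.m+[n∸m]≡n k-bound)) (cong (λ k → 3 * k + 3 * t + 1 + e) k≡t+A)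

  M≡ : M ≡ 2 * A + 5 * t + e
  M≡ = begin
    n ∸ k ∸ 1                               ≡⟨ ℕP.∸-+-assoc n k 1 ⟩
    n ∸ (k + 1)                             ≡⟨ cong₂ _∸_ n≡ (cong (_+ 1) k≡t+A) ⟩
    3 * (t + A) + 3 * t + 1 + e ∸ (t + A + 1) ≡⟨ cong (_∸ (t + A + 1)) (split t A e) ⟩
    t + A + 1 + (2 * A + 5 * t + e) ∸ (t + A + 1) ≡⟨ ℕP.m+n∸m≡n (t + A + 1) _ ⟩
    2 * A + 5 * t + e                       ∎
    where
    split : ∀ t A e → 3 * (t + A) + 3 * t + 1 + e ≡ t + A + 1 + (2 * A + 5 * t + e)
    split = ℕSolver.solve-∀

  n∸t≡ : n ∸ t ≡ suc (A + M)
  n∸t≡ = begin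
    n ∸ t                                   ≡⟨ cong (_∸ t) n≡ ⟩
    3 * (t + A) + 3 * t + 1 + e ∸ t         ≡⟨ cong (_∸ t) (split t A e) ⟩
    t + suc (A + (2 * A + 5 * t + e)) ∸ t   ≡⟨ ℕP.m+n∸m≡n t _ ⟩
    suc (A + (2 * A + 5 * t + e))           ≡⟨ cong (λ z → suc (A + z)) M≡ ⟨
    suc (A + M)                             ∎
    where
    split : ∀ t A e → 3 * (t + A) + 3 * t + 1 + e ≡ t + suc (A + (2 * A + 5 * t + e))
    split = ℕSolver.solve-∀

  k+1∸t≡A+1 : k + 1 ∸ t ≡ A + 1
  k+1∸t≡A+1 = trans (ℕP.+-∸-comm 1 (ℕP.m+n≤o⇒m≤o t t+2≤k)) (cong (_+ 1) k∸t≡A)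

  2A+5+e≤M : 2 * A + 5 + e ≤ M
  2A+5+e≤M = ℕP.≤-trans (ℕP.+-monoˡ-≤ e (ℕP.+-monoʳ-≤ (2 * A) (ℕP.*-monoʳ-≤ 5 1≤t))) (ℕP.≤-reflexive (sym M≡))

  2A+4≤M : 2 * A + 4 ≤ M
  2A+4≤M = ℕP.≤-trans (ℕP.≤-trans (ℕP.+-monoʳ-≤ (2 * A) (ℕP.n≤1+n 4)) (ℕP.m≤m+n (2 * A + 5) e)) 2A+5+e≤M

  e+A+2≤M : e + A + 2 ≤ M
  e+A+2≤M = ℕP.≤-trans (ℕP.≤-trans (ℕP.m≤m+n (e + A + 2) (A + 3)) (ℕP.≤-reflexive (rearrange e A))) 2A+5+e≤M
    where
    rearrange : ∀ e A → e + A + 2 + (A + 3) ≡ 2 * A + 5 + e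
    rearrange = ℕSolver.solve-∀

module Rationals where
  open import Data.Integer as ℤ using (+_)
  import Data.Integer.Properties as ℤP
  open import Data.Product using (_×_; _,_)
  open import Data.Rational as ℚ using (ℚ; 0ℚ; 1ℚ; _+_; _*_; _-_; _≤_; _<_)
  import Data.Rational.Properties as ℚP
  open import Data.Rational.Solver using (module +-*-Solver)
  open import Data.Rational.Unnormalised as ℚᵘ using (mkℚᵘ; *≡*; *≤*; *<*)
  import Data.Rational.Unnormalised.Properties as ℚᵘP
  open import Data.Unit using (tt)
  open +-*-Solver using (solve; _:+_; _:*_; _:-_; con; _:=_)

  -- frac x (suc d) is by definition fromℚᵘ (mkℚᵘ (+ x) d), so identities and inequalities
  -- between fractions reduce to cross-multiplication in ℚᵘ.
  private
    toℚᵘ-frac : ∀ x d → ℚ.toℚᵘ (frac x (suc d)) ℚᵘ.≃ mkℚᵘ (+ x) d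
    toℚᵘ-frac x d = ℚP.toℚᵘ-fromℚᵘ (mkℚᵘ (+ x) d)

    pos-*-pos : ∀ a b → + a ℤ.* + b ≡ + (a ℕ.* b)
    pos-*-pos a b = sym (ℤP.pos-* a b)

  frac-cross-≡ : ∀ a {b} c {e} → 0 ℕ.< b → 0 ℕ.< e → a ℕ.* e ≡ c ℕ.* b → frac a b ≡ frac c e
  frac-cross-≡ a {suc b} c {suc e} _ _ eq = ℚP.toℚᵘ-injective (begin
    ℚ.toℚᵘ (frac a (suc b)) ≈⟨ toℚᵘ-frac a b ⟩
    mkℚᵘ (+ a) b            ≈⟨ *≡* (trans (pos-*-pos a (suc e)) (trans (cong +_ eq) (sym (pos-*-pos c (suc b))))) ⟩
    mkℚᵘ (+ c) e            ≈⟨ toℚᵘ-frac c e ⟨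
    ℚ.toℚᵘ (frac c (suc e)) ∎)
    where open ℚᵘP.≃-Reasoning

  frac-cross-≤ : ∀ a {b} c {e} → 0 ℕ.< b → 0 ℕ.< e → a ℕ.* e ℕ.≤ c ℕ.* b → frac a b ≤ frac c e
  frac-cross-≤ a {suc b} c {suc e} _ _ le = ℚP.toℚᵘ-cancel-≤
    (ℚᵘP.≤-respˡ-≃ (ℚᵘP.≃-sym (toℚᵘ-frac a b)) (ℚᵘP.≤-respʳ-≃ (ℚᵘP.≃-sym (toℚᵘ-frac c e))
      (*≤* (subst₂ ℤ._≤_ (ℤP.pos-* a (suc e)) (ℤP.pos-* c (suc b)) (ℤ.+≤+ le)))))

  frac-cross-< : ∀ a {b} c {e} → 0 ℕ.< b → 0 ℕ.< e → a ℕ.* e ℕ.< c ℕ.* b → frac a b < frac c e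
  frac-cross-< a {suc b} c {suc e} _ _ lt = ℚP.toℚᵘ-cancel-<
    (ℚᵘP.<-respˡ-≃ (ℚᵘP.≃-sym (toℚᵘ-frac a b)) (ℚᵘP.<-respʳ-≃ (ℚᵘP.≃-sym (toℚᵘ-frac c e))
      (*<* (subst₂ ℤ._<_ (ℤP.pos-* a (suc e)) (ℤP.pos-* c (suc b)) (ℤ.+<+ lt)))))

  frac-* : ∀ a {b} c {e} → 0 ℕ.< b → 0 ℕ.< e → frac a b * frac c e ≡ frac (a ℕ.* c) (b ℕ.* e)
  frac-* a {suc b} c {suc e} _ _ = ℚP.toℚᵘ-injective (begin
    ℚ.toℚᵘ (frac a (suc b) * frac c (suc e))             ≈⟨ ℚP.toℚᵘ-homo-* (frac a (suc b)) (frac c (suc e)) ⟩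
    ℚ.toℚᵘ (frac a (suc b)) ℚᵘ.* ℚ.toℚᵘ (frac c (suc e)) ≈⟨ ℚᵘP.*-cong (toℚᵘ-frac a b) (toℚᵘ-frac c e) ⟩
    mkℚᵘ (+ a ℤ.* + c) (e ℕ.+ b ℕ.* suc e)             ≡⟨ cong (λ z → mkℚᵘ z (e ℕ.+ b ℕ.* suc e)) (pos-*-pos a c) ⟩
    mkℚᵘ (+ (a ℕ.* c)) (e ℕ.+ b ℕ.* suc e)             ≈⟨ toℚᵘ-frac (a ℕ.* c) (e ℕ.+ b ℕ.* suc e) ⟨
    ℚ.toℚᵘ (frac (a ℕ.* c) (suc b ℕ.* suc e))            ∎)
    where open ℚᵘP.≃-Reasoning

  frac-+ : ∀ a {b} c {e} → 0 ℕ.< b → 0 ℕ.< e → frac a b + frac c e ≡ frac (a ℕ.* e ℕ.+ c ℕ.* b) (b ℕ.* e)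
  frac-+ a {suc b} c {suc e} _ _ = ℚP.toℚᵘ-injective (begin
    ℚ.toℚᵘ (frac a (suc b) + frac c (suc e))             ≈⟨ ℚP.toℚᵘ-homo-+ (frac a (suc b)) (frac c (suc e)) ⟩
    ℚ.toℚᵘ (frac a (suc b)) ℚᵘ.+ ℚ.toℚᵘ (frac c (suc e)) ≈⟨ ℚᵘP.+-cong (toℚᵘ-frac a b) (toℚᵘ-frac c e) ⟩
    mkℚᵘ (+ a ℤ.* + suc e ℤ.+ + c ℤ.* + suc b) (e ℕ.+ b ℕ.* suc e)
      ≡⟨ cong (λ z → mkℚᵘ z (e ℕ.+ b ℕ.* suc e)) numerator ⟩
    mkℚᵘ (+ (a ℕ.* suc e ℕ.+ c ℕ.* suc b)) (e ℕ.+ b ℕ.* suc e)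
      ≈⟨ toℚᵘ-frac (a ℕ.* suc e ℕ.+ c ℕ.* suc b) (e ℕ.+ b ℕ.* suc e) ⟨
    ℚ.toℚᵘ (frac (a ℕ.* suc e ℕ.+ c ℕ.* suc b) (suc b ℕ.* suc e)) ∎)
    where
    open ℚᵘP.≃-Reasoning
    numerator : + a ℤ.* + suc e ℤ.+ + c ℤ.* + suc b ≡ + (a ℕ.* suc e ℕ.+ c ℕ.* suc b)
    numerator = trans (cong₂ ℤ._+_ (pos-*-pos a (suc e)) (pos-*-pos c (suc b))) (sym (ℤP.pos-+ (a ℕ.* suc e) (c ℕ.* suc b)))

  ι-+ : ∀ x y → ι (x ℕ.+ y) ≡ ι x + ι y
  ι-+ x y = sym (trans (frac-+ x y ℕ.z<s ℕ.z<s) (frac-cross-≡ (x ℕ.* 1 ℕ.+ y ℕ.* 1) (x ℕ.+ y) ℕ.z<s ℕ.z<s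
    (cong (ℕ._* 1) (cong₂ ℕ._+_ (ℕP.*-identityʳ x) (ℕP.*-identityʳ y)))))

  ι-* : ∀ x y → ι (x ℕ.* y) ≡ ι x * ι y
  ι-* x y = sym (frac-* x y ℕ.z<s ℕ.z<s)

  ι-mono-≤ : ∀ {x y} → x ℕ.≤ y → ι x ≤ ι y
  ι-mono-≤ {x} {y} x≤y = frac-cross-≤ x y ℕ.z<s ℕ.z<s (ℕP.*-monoˡ-≤ 1 x≤y)

  ι-mono-< : ∀ {x y} → x ℕ.< y → ι x < ι y
  ι-mono-< {x} {y} x<y = frac-cross-< x y ℕ.z<s ℕ.z<s (ℕP.*-monoˡ-< 1 x<y)

  ι-nonNeg : ∀ x → 0ℚ ≤ ι x
  ι-nonNeg x = ι-mono-≤ {0} {x} z≤n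

  ι-∸ : ∀ {x y} → y ℕ.≤ x → ι (x ℕ.∸ y) ≡ ι x - ι y
  ι-∸ {x} {y} y≤x = begin
    ι (x ℕ.∸ y)               ≡⟨ +-∸-cancel (ι (x ℕ.∸ y)) (ι y) ⟩
    ι (x ℕ.∸ y) + ι y - ι y   ≡⟨ cong (_- ι y) (ι-+ (x ℕ.∸ y) y) ⟨
    ι (x ℕ.∸ y ℕ.+ y) - ι y   ≡⟨ cong (λ z → ι z - ι y) (ℕP.m∸n+n≡m y≤x) ⟩
    ι x - ι y                 ∎
    where
    open ≡-Reasoning
    +-∸-cancel : ∀ a b → a ≡ a + b - b
    +-∸-cancel = solve 2 (λ a b → a := a :+ b :- b) refl

  frac-nonNeg : ∀ x y → 0ℚ ≤ frac x y
  frac-nonNeg x zero    = ℚP.≤-refl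
  frac-nonNeg x (suc y) = frac-cross-≤ 0 {1} x ℕ.z<s ℕ.z<s z≤n

  ι*frac : ∀ x z {y} → 0 ℕ.< y → ι x * frac z y ≡ frac (x ℕ.* z) y
  ι*frac x z {y} 0<y = trans (frac-* x z ℕ.z<s 0<y)
    (frac-cross-≡ (x ℕ.* z) (x ℕ.* z) (ℕP.*-monoʳ-< 1 0<y) 0<y (cong (x ℕ.* z ℕ.*_) (sym (ℕP.*-identityˡ y))))

  frac-*ι : ∀ x {y} → 0 ℕ.< y → frac x y * ι y ≡ ι x
  frac-*ι x {y} 0<y = trans (frac-* x y 0<y ℕ.z<s)
    (frac-cross-≡ (x ℕ.* y) x (ℕP.*-monoˡ-< 1 0<y) ℕ.z<s (trans (ℕP.*-identityʳ (x ℕ.* y)) (cong (x ℕ.*_) (sym (ℕP.*-identityʳ y)))))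

  frac-+-same : ∀ x z {y} → 0 ℕ.< y → frac x y + frac z y ≡ frac (x ℕ.+ z) y
  frac-+-same x z {y} 0<y = trans (frac-+ x z 0<y 0<y)
    (frac-cross-≡ (x ℕ.* y ℕ.+ z ℕ.* y) (x ℕ.+ z) (ℕP.*-mono-< 0<y 0<y) 0<y (rearrange x z y))
    where
    rearrange : ∀ x z y → (x ℕ.* y ℕ.+ z ℕ.* y) ℕ.* y ≡ (x ℕ.+ z) ℕ.* (y ℕ.* y)
    rearrange = ℕSolver.solve-∀

  ι≡frac : ∀ x {y} → 0 ℕ.< y → ι x ≡ frac (x ℕ.* y) y
  ι≡frac x {y} 0<y = frac-cross-≡ x (x ℕ.* y) ℕ.z<s 0<y (sym (ℕP.*-identityʳ (x ℕ.* y)))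

  frac≡ι*frac1 : ∀ x {y} → 0 ℕ.< y → frac x y ≡ ι x * frac 1 y
  frac≡ι*frac1 x {y} 0<y = sym (trans (ι*frac x 1 0<y) (cong (λ z → frac z y) (ℕP.*-identityʳ x)))

  frac-∸ : ∀ {u d} w → 0 ℕ.< u → 0 ℕ.< w → d ℕ.≤ u → frac (u ℕ.∸ d) w ≡ frac u w * (1ℚ - frac d u)
  frac-∸ {u} {d} w 0<u 0<w d≤u = begin
    frac (u ℕ.∸ d) w                           ≡⟨ frac≡ι*frac1 (u ℕ.∸ d) 0<w ⟩
    ι (u ℕ.∸ d) * frac 1 w                     ≡⟨ cong (_* frac 1 w) (ι-∸ d≤u) ⟩
    (ι u - ι d) * frac 1 w                     ≡⟨ cong (λ z → (ι u - z) * frac 1 w) (frac-*ι d 0<u) ⟨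
    (ι u - frac d u * ι u) * frac 1 w          ≡⟨ factor (ι u) (frac d u) (frac 1 w) ⟩
    ι u * frac 1 w * (1ℚ - frac d u)           ≡⟨ cong (_* (1ℚ - frac d u)) (frac≡ι*frac1 u 0<w) ⟨
    frac u w * (1ℚ - frac d u)                 ∎
    where
    open ≡-Reasoning
    factor : ∀ x r c → (x - r * x) * c ≡ x * c * (1ℚ - r)
    factor = solve 3 (λ x r c → (x :- r :* x) :* c := x :* c :* (con 1ℚ :- r)) refl

  ≤-by-gap : ∀ {p q} r → 0ℚ ≤ r → q ≡ p + r → p ≤ q
  ≤-by-gap {p} r 0≤r refl = subst (_≤ p + r) (ℚP.+-identityʳ p) (ℚP.+-monoʳ-≤ p 0≤r)

  <-by-gap : ∀ {p q} r → 0ℚ < r → q ≡ p + r → p < q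
  <-by-gap {p} r 0<r refl = subst (_< p + r) (ℚP.+-identityʳ p) (ℚP.+-monoʳ-< p 0<r)

  p≤q⇒0≤q-p : ∀ {p q} → p ≤ q → 0ℚ ≤ q - p
  p≤q⇒0≤q-p {p} {q} p≤q = subst (_≤ q - p) (ℚP.+-inverseʳ p) (ℚP.+-monoˡ-≤ (ℚ.- p) p≤q)

  0≤+ : ∀ {p q} → 0ℚ ≤ p → 0ℚ ≤ q → 0ℚ ≤ p + q
  0≤+ = ℚP.+-mono-≤

  0<+ : ∀ {p q} → 0ℚ < p → 0ℚ ≤ q → 0ℚ < p + q
  0<+ = ℚP.+-mono-<-≤

  0≤* : ∀ {p q} → 0ℚ ≤ p → 0ℚ ≤ q → 0ℚ ≤ p * q
  0≤* {p} {q} 0≤p 0≤q = ℚP.nonNegative⁻¹ _ {{ℚP.nonNeg*nonNeg⇒nonNeg p {{ℚ.nonNegative 0≤p}} q {{ℚ.nonNegative 0≤q}}}}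

  0<* : ∀ {p q} → 0ℚ < p → 0ℚ < q → 0ℚ < p * q
  0<* {p} {q} 0<p 0<q = ℚP.positive⁻¹ _ {{ℚP.pos*pos⇒pos p {{ℚ.positive 0<p}} q {{ℚ.positive 0<q}}}}

  ∏< : ℕ → (ℕ → ℚ) → ℚ
  ∏< n f = foldr _*_ 1ℚ (applyUpTo f n)

  syntax ∏< n (λ i → e) = ∏[ i < n ] e

  ∑< : ℕ → (ℕ → ℚ) → ℚ
  ∑< n f = foldr _+_ 0ℚ (applyUpTo f n)

  syntax ∑< n (λ i → e) = ∑[ i < n ] e

  ∏-cong : ∀ n {f g} → (∀ i → i ℕ.< n → f i ≡ g i) → ∏< n f ≡ ∏< n g
  ∏-cong zero    f≡g = refl
  ∏-cong (suc n) f≡g = cong₂ _*_ (f≡g 0 ℕ.z<s) (∏-cong n (λ i i<n → f≡g (suc i) (s≤s i<n)))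

  ∏-* : ∀ n f g → ∏[ i < n ] (f i * g i) ≡ ∏< n f * ∏< n g
  ∏-* zero    f g = refl
  ∏-* (suc n) f g = trans (cong (f 0 * g 0 *_) (∏-* n (f ∘ suc) (g ∘ suc)))
                          (interchange (f 0) (g 0) (∏< n (f ∘ suc)) (∏< n (g ∘ suc)))
    where
    interchange : ∀ a b c d → a * b * (c * d) ≡ a * c * (b * d)
    interchange = solve 4 (λ a b c d → a :* b :* (c :* d) := a :* c :* (b :* d)) refl

  ∏-ι : ∀ n x → ∏[ i < n ] ι x ≡ ι (x ℕ.^ n)
  ∏-ι zero    x = refl
  ∏-ι (suc n) x = trans (cong (ι x *_) (∏-ι n x)) (sym (ι-* x (x ℕ.^ n)))

  ∏-nonNeg : ∀ n {f} → (∀ i → i ℕ.< n → 0ℚ ≤ f i) → 0ℚ ≤ ∏< n f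
  ∏-nonNeg zero    _   = ℚP.≤ᵇ⇒≤ tt
  ∏-nonNeg (suc n) 0≤f = 0≤* (0≤f 0 ℕ.z<s) (∏-nonNeg n (λ i i<n → 0≤f (suc i) (s≤s i<n)))

  1≤∏ : ∀ n {f} → (∀ i → i ℕ.< n → 1ℚ ≤ f i) → 1ℚ ≤ ∏< n f
  1≤∏ zero    _   = ℚP.≤-refl
  1≤∏ (suc n) {f} 1≤f = begin
    1ℚ                   ≤⟨ 1≤P ⟩
    P                    ≡⟨ ℚP.*-identityˡ P ⟨
    1ℚ * P               ≤⟨ ℚP.*-monoʳ-≤-nonNeg P {{ℚ.nonNegative 0≤P}} (1≤f 0 ℕ.z<s) ⟩
    f 0 * P              ∎
    where
    open ℚP.≤-Reasoning
    P : ℚ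
    P = ∏< n (f ∘ suc)
    1≤P : 1ℚ ≤ P
    1≤P = 1≤∏ n (λ i i<n → 1≤f (suc i) (s≤s i<n))
    0≤P : 0ℚ ≤ P
    0≤P = ℚP.≤-trans (ℚP.≤ᵇ⇒≤ tt) 1≤P

  ∑-nonNeg : ∀ n {f} → (∀ i → i ℕ.< n → 0ℚ ≤ f i) → 0ℚ ≤ ∑< n f
  ∑-nonNeg zero    _   = ℚP.≤-refl
  ∑-nonNeg (suc n) 0≤f = 0≤+ (0≤f 0 ℕ.z<s) (∑-nonNeg n (λ i i<n → 0≤f (suc i) (s≤s i<n)))

  ∑-mono : ∀ n {f g} → (∀ i → i ℕ.< n → f i ≤ g i) → ∑< n f ≤ ∑< n g
  ∑-mono zero    _   = ℚP.≤-refl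
  ∑-mono (suc n) f≤g = ℚP.+-mono-≤ (f≤g 0 ℕ.z<s) (∑-mono n (λ i i<n → f≤g (suc i) (s≤s i<n)))

  ∑-≤-const : ∀ n {f} c → (∀ i → i ℕ.< n → f i ≤ c) → ∑< n f ≤ ι n * c
  ∑-≤-const zero    c _   = ℚP.≤-reflexive (sym (ℚP.*-zeroˡ c))
  ∑-≤-const (suc n) c f≤c = begin
    _                    ≤⟨ ℚP.+-mono-≤ (f≤c 0 ℕ.z<s) (∑-≤-const n c (λ i i<n → f≤c (suc i) (s≤s i<n))) ⟩
    c + ι n * c          ≡⟨ distrib (ι n) c ⟩
    (1ℚ + ι n) * c       ≡⟨ cong (_* c) (ι-+ 1 n) ⟨
    ι (suc n) * c        ∎
    where
    open ℚP.≤-Reasoning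
    distrib : ∀ x c → c + x * c ≡ (1ℚ + x) * c
    distrib = solve 2 (λ x c → c :+ x :* c := (con 1ℚ :+ x) :* c) refl

  ∑-frac : ∀ n f {y} → 0 ℕ.< y → ∑[ i < n ] frac (f i) y ≡ frac (sum (applyUpTo f n)) y
  ∑-frac zero    f 0<y = frac-cross-≡ 0 {1} 0 ℕ.z<s 0<y refl
  ∑-frac (suc n) f {y} 0<y = trans (cong (λ z → frac (f 0) y + z) (∑-frac n (f ∘ suc) 0<y)) (frac-+-same (f 0) _ 0<y)

  bonferroni : ∀ n r → (∀ i → i ℕ.< n → 0ℚ ≤ r i) → (∀ i → i ℕ.< n → r i ≤ 1ℚ) →
               ∏[ i < n ] (1ℚ - r i) ≤ 1ℚ - ∑< n r + ∑< n r * ∑< n r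
  bonferroni zero    r _   _   = ℚP.≤ᵇ⇒≤ tt
  bonferroni (suc n) r 0≤r r≤1 = begin
    (1ℚ - x) * ∏[ i < n ] (1ℚ - r (suc i)) ≤⟨ ℚP.*-monoˡ-≤-nonNeg (1ℚ - x) {{ℚ.nonNegative (p≤q⇒0≤q-p (r≤1 0 ℕ.z<s))}}
                                                (bonferroni n (r ∘ suc) (λ i i<n → 0≤r (suc i) (s≤s i<n)) (λ i i<n → r≤1 (suc i) (s≤s i<n))) ⟩
    (1ℚ - x) * (1ℚ - S + S * S)             ≤⟨ ≤-by-gap _ (0≤+ (0≤+ (0≤* 0≤x 0≤x) (0≤* 0≤x 0≤S)) (0≤* (0≤* 0≤x 0≤S) 0≤S)) (expand x S) ⟩
    1ℚ - (x + S) + (x + S) * (x + S)        ∎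
    where
    open ℚP.≤-Reasoning
    x S : ℚ
    x = r 0
    S = ∑< n (r ∘ suc)
    0≤x : 0ℚ ≤ x
    0≤x = 0≤r 0 ℕ.z<s
    0≤S : 0ℚ ≤ S
    0≤S = ∑-nonNeg n (λ i i<n → 0≤r (suc i) (s≤s i<n))
    expand : ∀ x S → 1ℚ - (x + S) + (x + S) * (x + S) ≡ (1ℚ - x) * (1ℚ - S + S * S) + (x * x + x * S + x * S * S)
    expand = solve 2 (λ x S → con 1ℚ :- (x :+ S) :+ (x :+ S) :* (x :+ S)
                           := (con 1ℚ :- x) :* (con 1ℚ :- S :+ S :* S) :+ (x :* x :+ x :* S :+ x :* S :* S)) refl

  κ*∑≤1-∏ : ∀ κ n r → (∀ i → i ℕ.< n → 0ℚ ≤ r i) → (∀ i → i ℕ.< n → r i ≤ 1ℚ) → ∑< n r ≤ 1ℚ - κ →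
            κ * ∑< n r ≤ 1ℚ - ∏[ i < n ] (1ℚ - r i)
  κ*∑≤1-∏ κ n r 0≤r r≤1 S≤1-κ = ≤-by-gap _
    (0≤+ (0≤* 0≤S (p≤q⇒0≤q-p S≤1-κ)) (p≤q⇒0≤q-p (bonferroni n r 0≤r r≤1))) (split κ S (∏[ i < n ] (1ℚ - r i)))
    where
    S : ℚ
    S = ∑< n r
    0≤S : 0ℚ ≤ S
    0≤S = ∑-nonNeg n 0≤r
    split : ∀ κ S P → 1ℚ - P ≡ κ * S + (S * (1ℚ - κ - S) + (1ℚ - S + S * S - P))
    split = solve 3 (λ κ S P → con 1ℚ :- P := κ :* S :+ (S :* (con 1ℚ :- κ :- S) :+ (con 1ℚ :- S :+ S :* S :- P))) refl

  product-lower-bounds : ∀ {κ B D G S μ} → 0ℚ ≤ κ → 1ℚ ≤ κ + κ → 0ℚ ≤ B → κ * B ≤ D →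
    (B + S) + (B + S) ≤ G → 0ℚ < S → 0ℚ ≤ μ →
    (κ * B * G < (D + S) * (G + μ)) × ((B + S) * (B + S) < (D + S) * (G + μ))
  product-lower-bounds {κ} {B} {D} {G} {S} {μ} 0≤κ 1≤2κ 0≤B κB≤D 2[B+S]≤G 0<S 0≤μ = first , second
    where
    open ℚP.≤-Reasoning
    0≤S : 0ℚ ≤ S
    0≤S = ℚP.<⇒≤ 0<S
    0<B+S : 0ℚ < B + S
    0<B+S = ℚP.≤-<-trans 0≤B (<-by-gap S 0<S refl)
    0≤G : 0ℚ ≤ G
    0≤G = ℚP.≤-trans (0≤+ (ℚP.<⇒≤ 0<B+S) (ℚP.<⇒≤ 0<B+S)) 2[B+S]≤G
    0<G : 0ℚ < G
    0<G = ℚP.<-≤-trans (0<+ 0<B+S (ℚP.<⇒≤ 0<B+S)) 2[B+S]≤G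
    0≤D : 0ℚ ≤ D
    0≤D = ℚP.≤-trans (0≤* 0≤κ 0≤B) κB≤D
    0≤κB+S : 0ℚ ≤ κ * B + S
    0≤κB+S = 0≤+ (0≤* 0≤κ 0≤B) 0≤S
    G≤G+μ : G ≤ G + μ
    G≤G+μ = ≤-by-gap μ 0≤μ refl
    expand : ∀ D S G μ → (D + S) * (G + μ) ≡ D * G + (S * G + (D + S) * μ)
    expand = solve 4 (λ D S G μ → (D :+ S) :* (G :+ μ) := D :* G :+ (S :* G :+ (D :+ S) :* μ)) refl
    square-gap : ∀ κ B S → (κ * B + S) * ((B + S) + (B + S)) ≡ (B + S) * (B + S) + (B + S) * ((κ + κ - 1ℚ) * B + S)
    square-gap = solve 3 (λ κ B S → (κ :* B :+ S) :* ((B :+ S) :+ (B :+ S)) := (B :+ S) :* (B :+ S) :+ (B :+ S) :* ((κ :+ κ :- con 1ℚ) :* B :+ S)) refl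

    first : κ * B * G < (D + S) * (G + μ)
    first = begin-strict
      κ * B * G             ≤⟨ ℚP.*-monoʳ-≤-nonNeg G {{ℚ.nonNegative 0≤G}} κB≤D ⟩
      D * G                 <⟨ <-by-gap _ (0<+ (0<* 0<S 0<G) (0≤* (0≤+ 0≤D 0≤S) 0≤μ)) (expand D S G μ) ⟩
      (D + S) * (G + μ)     ∎

    second : (B + S) * (B + S) < (D + S) * (G + μ)
    second = begin-strict
      (B + S) * (B + S)                 <⟨ <-by-gap _ (0<* 0<B+S (ℚP.≤-<-trans (0≤* (p≤q⇒0≤q-p 1≤2κ) 0≤B) (<-by-gap S 0<S refl)))
                                                      (square-gap κ B S) ⟩
      (κ * B + S) * ((B + S) + (B + S)) ≤⟨ ℚP.*-monoˡ-≤-nonNeg (κ * B + S) {{ℚ.nonNegative 0≤κB+S}} 2[B+S]≤G ⟩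
      (κ * B + S) * G                   ≤⟨ ℚP.*-monoʳ-≤-nonNeg G {{ℚ.nonNegative 0≤G}} (ℚP.+-monoˡ-≤ S κB≤D) ⟩
      (D + S) * G                       ≤⟨ ℚP.*-monoˡ-≤-nonNeg (D + S) {{ℚ.nonNegative (0≤+ 0≤D 0≤S)}} G≤G+μ ⟩
      (D + S) * (G + μ)                 ∎

module GaussianBinomials where
  open import Data.Product using (_×_; map₁)
  open import Data.Rational as ℚ using (ℚ; 0ℚ; 1ℚ; _+_; _*_; _-_; _≤_; _<_)
  import Data.Rational.Properties as ℚP
  open import Data.Rational.Solver using (module +-*-Solver)
  open import Data.Unit using (tt)
  open +-*-Solver using (solve; _:+_; _:*_; _:-_; con; _:=_)
  open Rationals

  gauss≡∏ : ∀ q a b → gauss q a b ≡ ∏[ i < b ] frac (q ℕ.^ (a ℕ.∸ i) ℕ.∸ 1) (q ℕ.^ (b ℕ.∸ i) ℕ.∸ 1)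
  gauss≡∏ q a b = cong (foldr _*_ 1ℚ) (List.map-upTo _ b)

  gauss-nonNeg : ∀ q a b → 0ℚ ≤ gauss q a b
  gauss-nonNeg q a b = subst (0ℚ ≤_) (sym (gauss≡∏ q a b))
    (∏-nonNeg b (λ i _ → frac-nonNeg (q ℕ.^ (a ℕ.∸ i) ℕ.∸ 1) (q ℕ.^ (b ℕ.∸ i) ℕ.∸ 1)))

  gauss-suc : ∀ q a b → gauss q (suc a) (suc b) ≡ frac (q ℕ.^ suc a ℕ.∸ 1) (q ℕ.^ suc b ℕ.∸ 1) * gauss q a b
  gauss-suc q a b = trans (gauss≡∏ q (suc a) (suc b)) (cong (frac (q ℕ.^ suc a ℕ.∸ 1) (q ℕ.^ suc b ℕ.∸ 1) *_) (sym (gauss≡∏ q a b)))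

  gauss-1 : ∀ q a → gauss q a 1 ≡ frac (q ℕ.^ a ℕ.∸ 1) (q ℕ.^ 1 ℕ.∸ 1)
  gauss-1 q a = ℚP.*-identityʳ _

  BoundsOnG₁ : (X Y G H s μ : ℚ) → Set
  BoundsOnG₁ X Y G H s μ = (frac 25 26 * X * Y * G < value) × ((X * Y + s) * (X * Y + s) < value)
    where
    value : ℚ
    value = (G - H + s) * (G + μ)

  module _ (p : ℕ) where
    open Powers p

    1≤gauss : ∀ a b → b ℕ.≤ a → 1ℚ ≤ gauss q a b
    1≤gauss a b b≤a = subst (1ℚ ≤_) (sym (gauss≡∏ q a b)) (1≤∏ b 1≤factor)
      where
      1≤factor : ∀ i → i ℕ.< b → 1ℚ ≤ frac (q ℕ.^ (a ℕ.∸ i) ℕ.∸ 1) (q ℕ.^ (b ℕ.∸ i) ℕ.∸ 1)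
      1≤factor i i<b = frac-cross-≤ 1 (q ℕ.^ (a ℕ.∸ i) ℕ.∸ 1) ℕ.z<s (0<q^-1 (b ℕ.∸ i) (ℕP.m<n⇒0<n∸m i<b))
        (subst₂ ℕ._≤_ (sym (ℕP.*-identityˡ _)) (sym (ℕP.*-identityʳ _)) (q^-1-mono (ℕP.∸-monoˡ-≤ i b≤a)))

    module _ (a′ M : ℕ) (2a+4≤M : 2 ℕ.* suc a′ ℕ.+ 4 ℕ.≤ M) where
      a m d c : ℕ
      a = suc a′
      m = suc (a ℕ.+ M)
      d = q ℕ.^ (a ℕ.+ 1) ℕ.∸ 1
      c = q ℕ.^ 1 ℕ.∸ 1

      u : ℕ → ℕ
      u i = q ℕ.^ (m ℕ.∸ i) ℕ.∸ 1

      r : ℕ → ℚ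
      r i = frac d (u i)

      g₀ G X Y H : ℚ
      g₀ = frac (u 0) (q ℕ.^ a ℕ.∸ 1)
      G = gauss q m a
      X = gauss q (a ℕ.+ 1) 1
      Y = gauss q (a ℕ.+ M) a′
      H = ι (q ℕ.^ (a ℕ.* (a ℕ.+ 1))) * gauss q M a

      a≤M : a ℕ.≤ M
      a≤M = ℕP.≤-trans (ℕP.≤-trans (ℕP.m≤m+n a (a ℕ.+ 0)) (ℕP.m≤m+n (2 ℕ.* a) 4)) 2a+4≤M

      2+M≤m∸i : ∀ {i} → i ℕ.< a → 2 ℕ.+ M ℕ.≤ m ℕ.∸ i
      2+M≤m∸i {i} (s≤s i≤a′) = ℕP.≤-trans (ℕP.≤-reflexive (sym m∸a′≡2+M)) (ℕP.∸-monoʳ-≤ m i≤a′)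
        where
        m∸a′≡2+M : m ℕ.∸ a′ ≡ 2 ℕ.+ M
        m∸a′≡2+M = trans (cong (ℕ._∸ a′) (sym (trans (ℕP.+-suc a′ (suc M)) (cong suc (ℕP.+-suc a′ M))))) (ℕP.m+n∸m≡n a′ (2 ℕ.+ M))

      0<u : ∀ {i} → i ℕ.< a → 0 ℕ.< u i
      0<u {i} i<a = 0<q^-1 (m ℕ.∸ i) (ℕP.≤-trans (s≤s z≤n) (2+M≤m∸i i<a))

      d≤u : ∀ {i} → i ℕ.< a → d ℕ.≤ u i
      d≤u {i} i<a = q^-1-mono {a ℕ.+ 1} {m ℕ.∸ i}
        (ℕP.≤-trans (ℕP.+-mono-≤ a≤M (ℕP.n≤1+n 1)) (ℕP.≤-trans (ℕP.≤-reflexive (ℕP.+-comm M 2)) (2+M≤m∸i i<a)))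

      G≡g₀*Y : G ≡ g₀ * Y
      G≡g₀*Y = gauss-suc q (a ℕ.+ M) a′

      H≡G*∏ : H ≡ G * ∏[ i < a ] (1ℚ - r i)
      H≡G*∏ = begin
        ι (q ℕ.^ (a ℕ.* (a ℕ.+ 1))) * gauss q M a
          ≡⟨ cong₂ _*_ (sym (trans (∏-ι a Q) (cong ι power))) (gauss≡∏ q M a) ⟩
        ∏[ i < a ] ι Q * ∏[ i < a ] frac (v i) (w i)
          ≡⟨ ∏-* a (λ _ → ι Q) (λ i → frac (v i) (w i)) ⟨
        ∏[ i < a ] (ι Q * frac (v i) (w i))
          ≡⟨ ∏-cong a factor ⟩
        ∏[ i < a ] (frac (u i) (w i) * (1ℚ - r i))
          ≡⟨ ∏-* a (λ i → frac (u i) (w i)) (λ i → 1ℚ - r i) ⟩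
        ∏[ i < a ] frac (u i) (w i) * ∏[ i < a ] (1ℚ - r i)
          ≡⟨ cong (_* ∏[ i < a ] (1ℚ - r i)) (gauss≡∏ q m a) ⟨
        G * ∏[ i < a ] (1ℚ - r i) ∎
        where
        open ≡-Reasoning
        Q : ℕ
        Q = q ℕ.^ (a ℕ.+ 1)
        v w : ℕ → ℕ
        v i = q ℕ.^ (M ℕ.∸ i) ℕ.∸ 1
        w i = q ℕ.^ (a ℕ.∸ i) ℕ.∸ 1
        power : Q ℕ.^ a ≡ q ℕ.^ (a ℕ.* (a ℕ.+ 1))
        power = trans (ℕP.^-*-assoc q (a ℕ.+ 1) a) (cong (q ℕ.^_) (ℕP.*-comm (a ℕ.+ 1) a))
        factor : ∀ i → i ℕ.< a → ι Q * frac (v i) (w i) ≡ frac (u i) (w i) * (1ℚ - r i)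
        factor i i<a = begin
          ι Q * frac (v i) (w i)          ≡⟨ ι*frac Q (v i) 0<w ⟩
          frac (Q ℕ.* v i) (w i)          ≡⟨ cong (λ z → frac z (w i)) (q^*[q^-1] (a ℕ.+ 1) (M ℕ.∸ i)) ⟩
          frac ((q ℕ.^ (a ℕ.+ 1 ℕ.+ (M ℕ.∸ i)) ℕ.∸ 1) ℕ.∸ d) (w i)
                                          ≡⟨ cong (λ j → frac ((q ℕ.^ j ℕ.∸ 1) ℕ.∸ d) (w i)) exponent ⟩
          frac (u i ℕ.∸ d) (w i)          ≡⟨ frac-∸ (w i) (0<u i<a) 0<w (d≤u i<a) ⟩
          frac (u i) (w i) * (1ℚ - r i)   ∎
          where
          0<w : 0 ℕ.< w i
          0<w = 0<q^-1 (a ℕ.∸ i) (ℕP.m<n⇒0<n∸m i<a)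
          exponent : a ℕ.+ 1 ℕ.+ (M ℕ.∸ i) ≡ m ℕ.∸ i
          exponent = trans (sym (ℕP.+-∸-assoc (a ℕ.+ 1) (ℕP.≤-trans (ℕP.<⇒≤ i<a) a≤M)))
                           (cong (ℕ._∸ i) (trans (ℕP.+-assoc a 1 M) (ℕP.+-suc a M)))

      0<c : 0 ℕ.< c
      0<c = 0<q^-1 1 ℕ.z<s

      0<q^a-1 : 0 ℕ.< q ℕ.^ a ℕ.∸ 1
      0<q^a-1 = 0<q^-1 a ℕ.z<s

      X≡frac : X ≡ frac d c
      X≡frac = gauss-1 q (a ℕ.+ 1)

      frac[d*q^i]u₀≤r : ∀ i → i ℕ.< a → frac (d ℕ.* q ℕ.^ i) (u 0) ≤ r i
      frac[d*q^i]u₀≤r i i<a = frac-cross-≤ (d ℕ.* q ℕ.^ i) d (0<u ℕ.z<s) (0<u i<a) (begin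
        d ℕ.* q ℕ.^ i ℕ.* u i                   ≡⟨ ℕP.*-assoc d (q ℕ.^ i) (u i) ⟩
        d ℕ.* (q ℕ.^ i ℕ.* u i)                 ≤⟨ ℕP.*-monoʳ-≤ d (q^*[q^-1]≤ i (m ℕ.∸ i)) ⟩
        d ℕ.* (q ℕ.^ (i ℕ.+ (m ℕ.∸ i)) ℕ.∸ 1)   ≡⟨ cong (λ j → d ℕ.* (q ℕ.^ j ℕ.∸ 1)) (ℕP.m+[n∸m]≡n i≤m) ⟩
        d ℕ.* u 0                               ∎)
        where
        open ℕP.≤-Reasoning
        i≤m : i ℕ.≤ m
        i≤m = ℕP.≤-trans (ℕP.<⇒≤ i<a) (ℕP.≤-trans (ℕP.m≤m+n a M) (ℕP.n≤1+n _))

      X≤g₀*∑r : X ≤ g₀ * ∑< a r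
      X≤g₀*∑r = begin
        X                                               ≡⟨ X≡frac ⟩
        frac d c                                        ≡⟨ frac-cross-≡ d (u 0 ℕ.* Sd) 0<c (ℕP.*-mono-< 0<q^a-1 (0<u ℕ.z<s)) cross ⟩
        frac (u 0 ℕ.* Sd) ((q ℕ.^ a ℕ.∸ 1) ℕ.* u 0)     ≡⟨ frac-* (u 0) Sd 0<q^a-1 (0<u ℕ.z<s) ⟨
        g₀ * frac Sd (u 0)                              ≡⟨ cong (g₀ *_) (∑-frac a (λ i → d ℕ.* q ℕ.^ i) (0<u ℕ.z<s)) ⟨
        g₀ * ∑[ i < a ] frac (d ℕ.* q ℕ.^ i) (u 0)
          ≤⟨ ℚP.*-monoˡ-≤-nonNeg g₀ {{ℚ.nonNegative (frac-nonNeg (u 0) (q ℕ.^ a ℕ.∸ 1))}} (∑-mono a frac[d*q^i]u₀≤r) ⟩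
        g₀ * ∑< a r                                     ∎
        where
        open ℚP.≤-Reasoning
        S Sd : ℕ
        S = sum (applyUpTo (q ℕ.^_) a)
        Sd = sum (applyUpTo (λ i → d ℕ.* q ℕ.^ i) a)
        regroup : ∀ d S c u → u ℕ.* (d ℕ.* S) ℕ.* c ≡ d ℕ.* (S ℕ.* c ℕ.* u)
        regroup = ℕSolver.solve-∀
        cross : d ℕ.* ((q ℕ.^ a ℕ.∸ 1) ℕ.* u 0) ≡ u 0 ℕ.* Sd ℕ.* c
        cross = sym (trans (cong (λ z → u 0 ℕ.* z ℕ.* c) (sum-applyUpTo-* d (q ℕ.^_) a))
                    (trans (regroup d S c (u 0)) (cong (λ z → d ℕ.* (z ℕ.* u 0)) (geometric-sum a))))

      0≤r : ∀ i → i ℕ.< a → 0ℚ ≤ r i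
      0≤r i _ = frac-nonNeg d (u i)

      r≤1 : ∀ i → i ℕ.< a → r i ≤ 1ℚ
      r≤1 i i<a = frac-cross-≤ d 1 (0<u i<a) ℕ.z<s
        (subst₂ ℕ._≤_ (sym (ℕP.*-identityʳ d)) (sym (ℕP.*-identityˡ (u i))) (d≤u i<a))

      r≤1/[26a] : ∀ i → i ℕ.< a → r i ≤ frac 1 (26 ℕ.* a)
      r≤1/[26a] i i<a = frac-cross-≤ d 1 (0<u i<a) ℕ.z<s
        (ℕP.≤-trans ([q^[a+1]-1]*26a≤q^j-1 a 2a+6≤m∸i) (ℕP.≤-reflexive (sym (ℕP.*-identityˡ (u i)))))
        where
        2a+6≤m∸i : 2 ℕ.* a ℕ.+ 6 ℕ.≤ m ℕ.∸ i
        2a+6≤m∸i = ℕP.≤-trans (ℕP.≤-reflexive (sym (ℕP.+-assoc (2 ℕ.* a) 4 2))) (ℕP.≤-trans (ℕP.+-monoˡ-≤ 2 2a+4≤M)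
                     (ℕP.≤-trans (ℕP.≤-reflexive (ℕP.+-comm M 2)) (2+M≤m∸i i<a)))

      ∑r≤1-25/26 : ∑< a r ≤ 1ℚ - frac 25 26
      ∑r≤1-25/26 = begin
        ∑< a r                        ≤⟨ ∑-≤-const a (frac 1 (26 ℕ.* a)) r≤1/[26a] ⟩
        ι a * frac 1 (26 ℕ.* a)       ≡⟨ ι*frac a 1 ℕ.z<s ⟩
        frac (a ℕ.* 1) (26 ℕ.* a)     ≤⟨ frac-cross-≤ (a ℕ.* 1) 1 ℕ.z<s ℕ.z<s (ℕP.≤-reflexive (cancel a)) ⟩
        frac 1 26                     ≡⟨⟩
        1ℚ - frac 25 26               ∎
        where
        open ℚP.≤-Reasoning
        cancel : ∀ a → a ℕ.* 1 ℕ.* 26 ≡ 1 ℕ.* (26 ℕ.* a)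
        cancel = ℕSolver.solve-∀

      25/26*XY≤G-H : frac 25 26 * (X * Y) ≤ G - H
      25/26*XY≤G-H = begin
        κ * (X * Y)                    ≤⟨ ℚP.*-monoˡ-≤-nonNeg κ {{ℚ.nonNegative (frac-nonNeg 25 26)}}
                                            (ℚP.*-monoʳ-≤-nonNeg Y {{ℚ.nonNegative (gauss-nonNeg q (a ℕ.+ M) a′)}} X≤g₀*∑r) ⟩
        κ * (g₀ * ∑< a r * Y)          ≡⟨ regroup κ g₀ (∑< a r) Y ⟩
        κ * ∑< a r * (g₀ * Y)          ≡⟨ cong (κ * ∑< a r *_) G≡g₀*Y ⟨
        κ * ∑< a r * G
          ≤⟨ ℚP.*-monoʳ-≤-nonNeg G {{ℚ.nonNegative (gauss-nonNeg q m a)}} (κ*∑≤1-∏ κ a r 0≤r r≤1 ∑r≤1-25/26) ⟩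
        (1ℚ - ∏[ i < a ] (1ℚ - r i)) * G ≡⟨ distrib G (∏[ i < a ] (1ℚ - r i)) ⟩
        G - G * ∏[ i < a ] (1ℚ - r i)  ≡⟨ cong (G -_) H≡G*∏ ⟨
        G - H                          ∎
        where
        open ℚP.≤-Reasoning
        κ : ℚ
        κ = frac 25 26
        regroup : ∀ κ g S Y → κ * (g * S * Y) ≡ κ * S * (g * Y)
        regroup = solve 4 (λ κ g S Y → κ :* (g :* S :* Y) := κ :* S :* (g :* Y)) refl
        distrib : ∀ G P → (1ℚ - P) * G ≡ G - G * P
        distrib = solve 2 (λ G P → (con 1ℚ :- P) :* G := G :- G :* P) refl

      module _ {e s : ℕ} (s≤q^e : s ℕ.≤ q ℕ.^ e) (e+a+2≤M : e ℕ.+ a ℕ.+ 2 ℕ.≤ M) where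
        [d+d+sc+sc]*[q^a-1]≤u₀*c : (d ℕ.+ d ℕ.+ s ℕ.* c ℕ.+ s ℕ.* c) ℕ.* (q ℕ.^ a ℕ.∸ 1) ℕ.≤ u 0 ℕ.* c
        [d+d+sc+sc]*[q^a-1]≤u₀*c = begin
          (d ℕ.+ d ℕ.+ s ℕ.* c ℕ.+ s ℕ.* c) ℕ.* (q ℕ.^ a ℕ.∸ 1)  ≤⟨ ℕP.*-monoˡ-≤ (q ℕ.^ a ℕ.∸ 1) (x+x+y+y≤q²*z d≤ sc≤) ⟩
          q ℕ.^ 2 ℕ.* q ℕ.^ E ℕ.* (q ℕ.^ a ℕ.∸ 1)               ≡⟨ cong (ℕ._* (q ℕ.^ a ℕ.∸ 1)) (ℕP.^-distribˡ-+-* q 2 E) ⟨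
          q ℕ.^ (2 ℕ.+ E) ℕ.* (q ℕ.^ a ℕ.∸ 1)                   ≤⟨ q^*[q^-1]≤ (2 ℕ.+ E) a ⟩
          q ℕ.^ (2 ℕ.+ E ℕ.+ a) ℕ.∸ 1                            ≤⟨ q^-1-mono exponent≤m ⟩
          u 0                                                    ≤⟨ ℕP.m≤m*n (u 0) c ⟩
          u 0 ℕ.* c                                              ∎
          where
          open ℕP.≤-Reasoning
          E : ℕ
          E = e ℕ.+ a ℕ.+ 1
          d≤ : d ℕ.≤ q ℕ.^ E
          d≤ = ℕP.≤-trans (ℕP.m∸n≤m (q ℕ.^ (a ℕ.+ 1)) 1)
                 (ℕP.^-monoʳ-≤ q (ℕP.≤-trans (ℕP.m≤n+m (a ℕ.+ 1) e) (ℕP.≤-reflexive (sym (ℕP.+-assoc e a 1)))))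
          sc≤ : s ℕ.* c ℕ.≤ q ℕ.^ E
          sc≤ = ℕP.≤-trans (ℕP.*-mono-≤ s≤q^e (ℕP.m∸n≤m (q ℕ.^ 1) 1))
                  (ℕP.≤-trans (ℕP.≤-reflexive (sym (ℕP.^-distribˡ-+-* q e 1)))
                    (ℕP.^-monoʳ-≤ q (ℕP.+-monoˡ-≤ 1 (ℕP.m≤m+n e a))))
          exponent≤m : 2 ℕ.+ E ℕ.+ a ℕ.≤ m
          exponent≤m = ℕP.≤-trans (ℕP.≤-reflexive (rearrange e a)) (s≤s (ℕP.+-monoʳ-≤ a e+a+2≤M))
            where
            rearrange : ∀ e a → 2 ℕ.+ (e ℕ.+ a ℕ.+ 1) ℕ.+ a ≡ suc (a ℕ.+ (e ℕ.+ a ℕ.+ 2))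
            rearrange = ℕSolver.solve-∀

        X+X+s+s≤g₀ : X + X + ι s + ι s ≤ g₀
        X+X+s+s≤g₀ = begin
          X + X + ι s + ι s                                   ≡⟨ cong₂ (λ x y → x + x + y + y) X≡frac (ι≡frac s 0<c) ⟩
          frac d c + frac d c + F + F                         ≡⟨ cong (λ z → z + F + F) (frac-+-same d d 0<c) ⟩
          frac (d ℕ.+ d) c + F + F                            ≡⟨ cong (_+ F) (frac-+-same (d ℕ.+ d) (s ℕ.* c) 0<c) ⟩
          frac (d ℕ.+ d ℕ.+ s ℕ.* c) c + F                    ≡⟨ frac-+-same (d ℕ.+ d ℕ.+ s ℕ.* c) (s ℕ.* c) 0<c ⟩
          frac (d ℕ.+ d ℕ.+ s ℕ.* c ℕ.+ s ℕ.* c) c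
            ≤⟨ frac-cross-≤ (d ℕ.+ d ℕ.+ s ℕ.* c ℕ.+ s ℕ.* c) (u 0) 0<c 0<q^a-1 [d+d+sc+sc]*[q^a-1]≤u₀*c ⟩
          g₀                                                  ∎
          where
          open ℚP.≤-Reasoning
          F : ℚ
          F = frac (s ℕ.* c) c

        2[XY+s]≤G : (X * Y + ι s) + (X * Y + ι s) ≤ G
        2[XY+s]≤G = subst ((X * Y + ι s) + (X * Y + ι s) ≤_) (sym G≡g₀*Y)
          (≤-by-gap _ (0≤+ (0≤* (p≤q⇒0≤q-p X+X+s+s≤g₀) 0≤Y) (0≤* (0≤+ (ι-nonNeg s) (ι-nonNeg s)) (p≤q⇒0≤q-p 1≤Y)))
            (split X Y (ι s) g₀))
          where
          1≤Y : 1ℚ ≤ Y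
          1≤Y = 1≤gauss (a ℕ.+ M) a′ (ℕP.≤-trans (ℕP.n≤1+n a′) (ℕP.m≤m+n a M))
          0≤Y : 0ℚ ≤ Y
          0≤Y = gauss-nonNeg q (a ℕ.+ M) a′
          split : ∀ X Y s g → g * Y ≡ (X * Y + s) + (X * Y + s) + ((g - (X + X + s + s)) * Y + (s + s) * (Y - 1ℚ))
          split = solve 4 (λ X Y s g → g :* Y := (X :* Y :+ s) :+ (X :* Y :+ s) :+ ((g :- (X :+ X :+ s :+ s)) :* Y :+ (s :+ s) :* (Y :- con 1ℚ))) refl

        boundsOnG₁ : ∀ {μ} → 1 ℕ.≤ s → 0ℚ ≤ μ → BoundsOnG₁ X Y G H (ι s) μ
        boundsOnG₁ {μ} 1≤s 0≤μ = map₁ (subst (λ z → z * G < (G - H + ι s) * (G + μ)) (sym (ℚP.*-assoc (frac 25 26) X Y)))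
          (product-lower-bounds (frac-nonNeg 25 26) (ℚP.≤ᵇ⇒≤ tt) (0≤* (gauss-nonNeg q (a ℕ.+ 1) 1) (gauss-nonNeg q (a ℕ.+ M) a′))
            25/26*XY≤G-H 2[XY+s]≤G (ι-mono-< 1≤s) 0≤μ)

  reindex : ∀ q n k t s {μ} a′ →
    k ℕ.∸ t ≡ suc a′ → k ℕ.+ 1 ℕ.∸ t ≡ suc a′ ℕ.+ 1 → n ℕ.∸ t ≡ suc (suc a′ ℕ.+ (n ℕ.∸ k ℕ.∸ 1)) →
    BoundsOnG₁ (gauss q (suc a′ ℕ.+ 1) 1) (gauss q (suc a′ ℕ.+ (n ℕ.∸ k ℕ.∸ 1)) a′)
               (gauss q (suc (suc a′ ℕ.+ (n ℕ.∸ k ℕ.∸ 1))) (suc a′))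
               (ι (q ℕ.^ (suc a′ ℕ.* (suc a′ ℕ.+ 1))) * gauss q (n ℕ.∸ k ℕ.∸ 1) (suc a′)) (ι s) μ →
    BoundsOnG₁ (gauss q (k ℕ.∸ t ℕ.+ 1) 1) (gauss q (n ℕ.∸ t ℕ.∸ 1) (k ℕ.∸ t ℕ.∸ 1)) (gauss q (n ℕ.∸ t) (k ℕ.∸ t))
               (ι (q ℕ.^ ((k ℕ.∸ t) ℕ.* (k ℕ.+ 1 ℕ.∸ t))) * gauss q (n ℕ.∸ k ℕ.∸ 1) (k ℕ.∸ t)) (ι s) μ
  reindex q n k t s a′ k∸t≡ k+1∸t≡ n∸t≡ bounds rewrite k∸t≡ | k+1∸t≡ | n∸t≡ = bounds

open import Data.Nat using (_+_; _*_; _∸_; _^_; _≤_)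
open import Data.Integer using (+_)
open import Data.Rational as ℚ using (_/_)
import Data.Rational.Properties as ℚP
open import Data.Product using (_×_)
open Rationals using (ι-nonNeg; 0≤*)
open GaussianBinomials

lemma2p5 : (q n k t s : ℕ) → IsPrimePower q → 2 ≤ q
    → 1 ≤ n → 1 ≤ k → 1 ≤ t → 1 ≤ s → t + 2 ≤ k
    → 3 * k + 3 * t + 1 ≤ n → 13 * s ≤ q ^ (n ∸ (3 * k + 3 * t + 1))
    → ((+ 25 / 26) ℚ.* gauss q (k ∸ t + 1) 1 ℚ.* gauss q (n ∸ t ∸ 1) (k ∸ t ∸ 1) ℚ.* gauss q (n ∸ t) (k ∸ t) ℚ.< g₁ q n k t s)
      × ((gauss q (k ∸ t + 1) 1 ℚ.* gauss q (n ∸ t ∸ 1) (k ∸ t ∸ 1) ℚ.+ ι s) ℚ.* (gauss q (k ∸ t + 1) 1 ℚ.* gauss q (n ∸ t ∸ 1) (k ∸ t ∸ 1) ℚ.+ ι s) ℚ.< g₁ q n k t s)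
lemma2p5 .(2 + p) n k t s _ (s≤s (s≤s {n = p} z≤n)) _ _ 1≤t 1≤s t+2≤k k-bound 13s≤q^e =
  reindex (2 + p) n k t s a′ k∸t≡A k+1∸t≡A+1 n∸t≡
    (boundsOnG₁ p a′ M 2A+4≤M (ℕP.≤-trans (ℕP.m≤n*m s 13) 13s≤q^e) e+A+2≤M 1≤s 0≤μ)
  where
  open Reindexing 1≤t t+2≤k k-bound
  0≤μ : ℚ.0ℚ ℚ.≤ ι s ℚ.⊓ (ι ((2 + p) ^ (k ∸ t + 1)) ℚ.* gauss (2 + p) t 1)
  0≤μ = ℚP.⊓-glb (ι-nonNeg s) (0≤* (ι-nonNeg ((2 + p) ^ (k ∸ t + 1))) (gauss-nonNeg (2 + p) t 1))
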